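{- Let $a,b$ be integers with $1\leq a\leq b$ and let $h\geq 0$ be an integer. Let $Q_{a,b}^{(h)}=U^{a+h}D^aU^bD^{b+h}$, and let $\varphi_h(a,b)$ denote the number of Dyck paths having exactly two peaks in the interval $[UD,Q_{a,b}^{(h)}]$ of the Dyck pattern poset. Then $$\varphi_h(a,b)=\varphi_0(a,b)+hab.$$
   Context: A Dyck path is a word over $\{U,D\}$ with equally many $U$'s and $D$'s such that every prefix has at least as many $U$'s as $D$'s. The Dyck pattern poset is the set of nonempty Dyck paths ordered by $P\leq Q$ iff $P$ is a subword of $Q$ (obtained by deleting letters, not necessarily consecutive). A peak is an occurrence of $UD$ as two consecutive letters. $U^a$ denotes $a$ consecutive $U$'s. In particular $\varphi_0(a,b)$ is the number of two-peak Dyck paths in $[UD,U^aD^aU^bD^b]$. The paper assumes throughout this section that $b\geq a\geq1$. -}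

module Defs where

open import Data.Nat using (ℕ; zero; suc; _+_; _*_; _≤_; _≟_)
open import Data.Bool using (Bool; true; false)
open import Data.List using (List; []; _∷_; _++_; replicate; length; filter; concatMap; map)
open import Data.Product using (_×_)
open import Relation.Nullary using (Dec; yes; no; _×-dec_)
open import Relation.Binary.PropositionalEquality using (_≡_; refl)
open import Relation.Binary.Definitions using (DecidableEquality)

data Step : Set where
  U D : Step

_≟S_ : DecidableEquality Step
U ≟S U = yes refl
U ≟S D = no λ ()
D ≟S U = no λ ()
D ≟S D = yes refl

Word : Set
Word = List Step

-- Subword (scattered subsequence) order from the standard library:
-- P ⊆ Q  iff  P is obtained from Q by deleting letters.
open import Data.List.Relation.Binary.Sublist.DecPropositional _≟S_
  using (_⊆_; _⊆?_) public

dyckFrom : ℕ → Word → Bool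
dyckFrom zero    []      = true
dyckFrom (suc _) []      = false
dyckFrom h       (U ∷ w) = dyckFrom (suc h) w
dyckFrom zero    (D ∷ w) = false
dyckFrom (suc h) (D ∷ w) = dyckFrom h w

IsDyck : Word → Set
IsDyck w = dyckFrom 0 w ≡ true

isDyck? : (w : Word) → Dec (IsDyck w)
isDyck? w with dyckFrom 0 w
... | true  = yes refl
... | false = no λ ()

peaks : Word → ℕ
peaks []           = 0
peaks (U ∷ D ∷ w)  = suc (peaks (D ∷ w))
peaks (U ∷ U ∷ w)  = peaks (U ∷ w)
peaks (U ∷ [])     = 0
peaks (D ∷ w)      = peaks w

wordsOfLength : ℕ → List Word
wordsOfLength zero    = [] ∷ []
wordsOfLength (suc n) = concatMap (λ w → (U ∷ w) ∷ (D ∷ w) ∷ []) (wordsOfLength n)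

wordsUpTo : ℕ → List Word
wordsUpTo zero    = wordsOfLength 0
wordsUpTo (suc n) = wordsOfLength (suc n) ++ wordsUpTo n

UD : Word
UD = U ∷ D ∷ []

Q : ℕ → ℕ → ℕ → Word
Q h a b = replicate (a + h) U ++ replicate a D ++ replicate b U ++ replicate (b + h) D

InIntervalTwoPeaks : Word → Word → Set
InIntervalTwoPeaks R P = IsDyck P × (UD ⊆ P) × (P ⊆ R) × (peaks P ≡ 2)

inIntervalTwoPeaks? : (R P : Word) → Dec (InIntervalTwoPeaks R P)
inIntervalTwoPeaks? R P =
  isDyck? P ×-dec (UD ⊆? P) ×-dec (P ⊆? R) ×-dec (peaks P ≟ 2)

-- Number of two-peak Dyck paths in [UD, R]. Every P ⊆ R has length ≤ |R|,
-- so enumerating all words of length ≤ |R| (each exactly once) is exhaustive.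
twoPeakCount : Word → ℕ
twoPeakCount R = length (filter (inIntervalTwoPeaks? R) (wordsUpTo (length R)))

φ : ℕ → ℕ → ℕ → ℕ
φ h a b = twoPeakCount (Q h a b)

module Submission where

-- A Dyck path with exactly two peaks is U^(q+x) D^q U^r D^(r+x) with q, r ≥ 1, where x is the height of
-- its valley, and it is a subword of U^(a+h) D^a U^b D^(b+h) iff each of its four runs fits into the
-- corresponding run. So for each of the a·b choices of (q, r) the admissible valley heights are
-- 0 ≤ x ≤ h + min(a − q, b − r): raising h by one adds exactly one admissible height for every (q, r).

open import Defs
open import Data.Bool using (true)
open import Data.Nat
open import Data.Nat.Properties
open import Data.Nat.Tactic.RingSolver using (solve-∀)
open import Data.Product using (∃-syntax; _×_; _,_; proj₁; proj₂)
open import Data.Sum using (_⊎_; inj₁; inj₂)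
open import Data.List using (List; []; _∷_; _++_; replicate; length; map; filter; concatMap; drop; downFrom; cartesianProduct)
open import Data.List.Properties using (length-++; length-map; length-replicate; length-downFrom)
open import Data.List.Membership.Propositional using (_∈_; find; lose)
open import Data.List.Membership.Propositional.Properties
  using (∈-++⁺ˡ; ∈-++⁺ʳ; ∈-++⁻; ∈-map⁺; ∈-map⁻; ∈-concatMap⁺; ∈-concatMap⁻; ∈-filter⁺; ∈-filter⁻;
         ∈-downFrom⁺; ∈-downFrom⁻; ∈-cartesianProduct⁺; ∈-cartesianProduct⁻)
open import Data.List.Membership.Propositional.Properties.WithK using (unique∧set⇒bag)
open import Data.List.Relation.Unary.Any using (here; there)
open import Data.List.Relation.Unary.All as All using ([]; _∷_)
open import Data.List.Relation.Unary.Unique.Propositional using (Unique; []; _∷_)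
import Data.List.Relation.Unary.Unique.Propositional.Properties as Unique
open import Data.List.Relation.Binary.Disjoint.Propositional using (Disjoint)
open import Data.List.Relation.Binary.BagAndSetEquality using (∼bag⇒↭)
open import Data.List.Relation.Binary.Permutation.Propositional.Properties using (↭-length)
open import Data.List.Relation.Binary.Sublist.Propositional using (_∷_; _∷ʳ_; ⊆-refl; ⊆-trans; ⊆-reflexive)
open import Data.List.Relation.Binary.Sublist.Propositional.Properties using (++⁺; ++⁺ˡ; ∷ˡ⁻; length-mono-≤; []⊆-universal)
open import Function using (_∘_; _⇔_; mk⇔; Equivalence)
open import Relation.Nullary using (¬_; contradiction)
open import Relation.Binary.PropositionalEquality

private variable
  A B : Set
  xs ys : List A
  x y : Step
  m n p q r s p′ q′ r′ s′ : ℕ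

Unique-concatMap⁺ : {f : A → List B} (tag : B → A) → (∀ x {y} → y ∈ f x → tag y ≡ x) →
                    (∀ x → Unique (f x)) → {xs : List A} → Unique xs → Unique (concatMap f xs)
Unique-concatMap⁺ tag tagged unique-f [] = []
Unique-concatMap⁺ {f = f} tag tagged unique-f {x ∷ xs} (x∉xs ∷ unique-xs) =
  Unique.++⁺ (unique-f x) (Unique-concatMap⁺ tag tagged unique-f unique-xs) disjoint
  where
  disjoint : Disjoint (f x) (concatMap f xs)
  disjoint (y∈fx , y∈rest) with x′ , x′∈xs , y∈fx′ ← find (∈-concatMap⁻ f y∈rest) =
    All.lookup x∉xs x′∈xs (trans (sym (tagged x y∈fx)) (tagged x′ y∈fx′))

length-concatMap-shift : (f g : A → List B) (c : ℕ) → (∀ x → length (f x) ≡ c + length (g x)) →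
                         ∀ xs → length (concatMap f xs) ≡ c * length xs + length (concatMap g xs)
length-concatMap-shift f g c shift [] = sym (cong (_+ 0) (*-zeroʳ c))
length-concatMap-shift f g c shift (x ∷ xs) = begin
  length (f x ++ concatMap f xs)
    ≡⟨ length-++ (f x) ⟩
  length (f x) + length (concatMap f xs)
    ≡⟨ cong₂ _+_ (shift x) (length-concatMap-shift f g c shift xs) ⟩
  c + length (g x) + (c * length xs + length (concatMap g xs))
    ≡⟨ interchange c (length (g x)) (length xs) (length (concatMap g xs)) ⟩
  c * suc (length xs) + (length (g x) + length (concatMap g xs))
    ≡⟨ cong (c * suc (length xs) +_) (sym (length-++ (g x))) ⟩
  c * suc (length xs) + length (g x ++ concatMap g xs) ∎
  where
  open ≡-Reasoning
  interchange : ∀ c m n k → c + m + (c * n + k) ≡ c * suc n + (m + k)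
  interchange = solve-∀

length-cartesianProduct : (xs : List A) (ys : List B) → length (cartesianProduct xs ys) ≡ length xs * length ys
length-cartesianProduct []       ys = refl
length-cartesianProduct (x ∷ xs) ys = begin
  length (map (x ,_) ys ++ cartesianProduct xs ys)
    ≡⟨ length-++ (map (x ,_) ys) ⟩
  length (map (x ,_) ys) + length (cartesianProduct xs ys)
    ≡⟨ cong₂ _+_ (length-map (x ,_) ys) (length-cartesianProduct xs ys) ⟩
  length ys + length xs * length ys ∎
  where open ≡-Reasoning

unique∧set⇒length≡ : Unique xs → Unique ys → (∀ {z} → (z ∈ xs) ⇔ (z ∈ ys)) → length xs ≡ length ys
unique∧set⇒length≡ unique-xs unique-ys xs≈ys =
  ↭-length (∼bag⇒↭ (unique∧set⇒bag unique-xs unique-ys xs≈ys))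

UDUD : ℕ → ℕ → ℕ → ℕ → Word
UDUD p q r s = replicate p U ++ replicate q D ++ replicate r U ++ replicate s D

valley : ℕ → ℕ → ℕ → Word
valley q x r = UDUD (q + x) q r (r + x)

U≢D : U ≢ D
U≢D ()

peaks-Uⁿ : ∀ n → peaks (replicate n U) ≡ 0
peaks-Uⁿ zero          = refl
peaks-Uⁿ (suc zero)    = refl
peaks-Uⁿ (suc (suc n)) = peaks-Uⁿ (suc n)

peaks-Dⁿ : ∀ n → peaks (replicate n D) ≡ 0
peaks-Dⁿ zero    = refl
peaks-Dⁿ (suc n) = peaks-Dⁿ n

peaks-Dⁿ++ : ∀ n w → peaks (replicate n D ++ w) ≡ peaks w
peaks-Dⁿ++ zero    w = refl
peaks-Dⁿ++ (suc n) w = peaks-Dⁿ++ n w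

peaks-U⁺D : ∀ n w → peaks (replicate (suc n) U ++ D ∷ w) ≡ suc (peaks w)
peaks-U⁺D zero    w = refl
peaks-U⁺D (suc n) w = peaks-U⁺D n w

peaks-UDUD : ∀ p q r s → peaks (UDUD (suc p) (suc q) (suc r) (suc s)) ≡ 2
peaks-UDUD p q r s = begin
  peaks (UDUD (suc p) (suc q) (suc r) (suc s))             ≡⟨ peaks-U⁺D p _ ⟩
  suc (peaks (replicate q D ++ replicate (suc r) U ++ _))   ≡⟨ cong suc (peaks-Dⁿ++ q _) ⟩
  suc (peaks (replicate (suc r) U ++ D ∷ replicate s D))   ≡⟨ cong suc (peaks-U⁺D r _) ⟩
  2 + peaks (replicate s D)                                ≡⟨ cong (2 +_) (peaks-Dⁿ s) ⟩
  2 ∎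
  where open ≡-Reasoning

dyckFrom-U : ∀ h w → dyckFrom h (U ∷ w) ≡ dyckFrom (suc h) w
dyckFrom-U zero    w = refl
dyckFrom-U (suc h) w = refl

dyckFrom-Uⁿ : ∀ n h w → dyckFrom h (replicate n U ++ w) ≡ dyckFrom (n + h) w
dyckFrom-Uⁿ zero    h w = refl
dyckFrom-Uⁿ (suc n) h w = begin
  dyckFrom h (U ∷ replicate n U ++ w)   ≡⟨ dyckFrom-U h _ ⟩
  dyckFrom (suc h) (replicate n U ++ w) ≡⟨ dyckFrom-Uⁿ n (suc h) w ⟩
  dyckFrom (n + suc h) w                ≡⟨ cong (λ k → dyckFrom k w) (+-suc n h) ⟩
  dyckFrom (suc n + h) w ∎
  where open ≡-Reasoning

dyckFrom-Dⁿ : ∀ n h w → dyckFrom (n + h) (replicate n D ++ w) ≡ dyckFrom h w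
dyckFrom-Dⁿ zero    h w = refl
dyckFrom-Dⁿ (suc n) h w = dyckFrom-Dⁿ n h w

dyckFrom-Dⁿ⁻ : ∀ n h w → dyckFrom h (replicate n D ++ w) ≡ true →
               ∃[ h′ ] h ≡ n + h′ × dyckFrom h′ w ≡ true
dyckFrom-Dⁿ⁻ zero    h       w dyck = h , refl , dyck
dyckFrom-Dⁿ⁻ (suc n) (suc h) w dyck with h′ , refl , dyck′ ← dyckFrom-Dⁿ⁻ n h w dyck = h′ , refl , dyck′

dyckFrom-Dⁿ-exact : ∀ n → dyckFrom n (replicate n D) ≡ true
dyckFrom-Dⁿ-exact zero    = refl
dyckFrom-Dⁿ-exact (suc n) = dyckFrom-Dⁿ-exact n

dyckFrom-Dⁿ-exact⁻ : ∀ n h → dyckFrom h (replicate n D) ≡ true → h ≡ n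
dyckFrom-Dⁿ-exact⁻ zero    zero    _    = refl
dyckFrom-Dⁿ-exact⁻ (suc n) (suc h) dyck = cong suc (dyckFrom-Dⁿ-exact⁻ n h dyck)

DyckSuffix : Word → Set
DyckSuffix w = ∃[ h ] dyckFrom h w ≡ true

DyckSuffix-++⁻ : ∀ xs → DyckSuffix (xs ++ ys) → DyckSuffix ys
DyckSuffix-++⁻ []       dyck                = dyck
DyckSuffix-++⁻ (U ∷ xs) (h , dyck)          = DyckSuffix-++⁻ xs (suc h , trans (sym (dyckFrom-U h _)) dyck)
DyckSuffix-++⁻ (D ∷ xs) (suc h , dyck)      = DyckSuffix-++⁻ xs (h , dyck)

DyckSuffix-U∷⇒peak : ∀ w → DyckSuffix (U ∷ w) → 0 < peaks (U ∷ w)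
DyckSuffix-U∷⇒peak (D ∷ w) _                = s≤s z≤n
DyckSuffix-U∷⇒peak (U ∷ w) (h , dyck)       = DyckSuffix-U∷⇒peak w (suc h , trans (sym (dyckFrom-U h _)) dyck)
DyckSuffix-U∷⇒peak []      (zero , ())
DyckSuffix-U∷⇒peak []      (suc h , ())

dyck-valley : ∀ q x r → IsDyck (valley q x r)
dyck-valley q x r = begin
  dyckFrom 0 (valley q x r)                              ≡⟨ dyckFrom-Uⁿ (q + x) 0 _ ⟩
  dyckFrom (q + x + 0) (UDUD 0 q r (r + x))
    ≡⟨ cong (λ k → dyckFrom k (UDUD 0 q r (r + x))) (+-identityʳ (q + x)) ⟩
  dyckFrom (q + x) (replicate q D ++ _)                  ≡⟨ dyckFrom-Dⁿ q x _ ⟩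
  dyckFrom x (replicate r U ++ replicate (r + x) D)      ≡⟨ dyckFrom-Uⁿ r x _ ⟩
  dyckFrom (r + x) (replicate (r + x) D)                 ≡⟨ dyckFrom-Dⁿ-exact (r + x) ⟩
  true ∎
  where open ≡-Reasoning

dyck-UDUD⁻ : ∀ p q r s → IsDyck (UDUD p q r s) → ∃[ x ] p ≡ q + x × s ≡ r + x
dyck-UDUD⁻ p q r s dyck
  with x , p+0≡q+x , dyck′ ← dyckFrom-Dⁿ⁻ q (p + 0) _ (trans (sym (dyckFrom-Uⁿ p 0 _)) dyck)
  = x , trans (sym (+-identityʳ p)) p+0≡q+x
      , sym (dyckFrom-Dⁿ-exact⁻ s (r + x) (trans (sym (dyckFrom-Uⁿ r x _)) dyck′))

other : Step → Step
other U = D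
other D = U

data LeadingRun (x : Step) : Word → Set where
  only       : ∀ n → LeadingRun x (replicate n x)
  followedBy : ∀ n w → LeadingRun x (replicate n x ++ other x ∷ w)

leadingRun : ∀ x w → LeadingRun x w
leadingRun x []      = only 0
leadingRun U (D ∷ w) = followedBy 0 w
leadingRun D (U ∷ w) = followedBy 0 w
leadingRun U (U ∷ w) with leadingRun U w
... | only n         = only (suc n)
... | followedBy n w = followedBy (suc n) w
leadingRun D (D ∷ w) with leadingRun D w
... | only n         = only (suc n)
... | followedBy n w = followedBy (suc n) w

twoPeakDyck⇒UDUD : ∀ w → IsDyck w → peaks w ≡ 2 →
                   ∃[ p ] ∃[ q ] ∃[ r ] ∃[ s ] w ≡ UDUD (suc p) (suc q) (suc r) (suc s)
twoPeakDyck⇒UDUD w dyck two with leadingRun U w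
... | only p              = contradiction (trans (sym (peaks-Uⁿ p)) two) λ ()
... | followedBy zero w₁  = contradiction dyck λ ()
... | followedBy (suc p) w₁ with leadingRun D w₁
...   | only q = contradiction (trans (sym one-peak) two) λ ()
  where
  one-peak : peaks (replicate (suc p) U ++ D ∷ replicate q D) ≡ 1
  one-peak = trans (peaks-U⁺D p _) (cong suc (peaks-Dⁿ q))
...   | followedBy q w₂ with leadingRun U w₂
...     | only r = contradiction (trans (sym one-peak) two) λ ()
  where
  one-peak : peaks (replicate (suc p) U ++ D ∷ replicate q D ++ replicate (suc r) U) ≡ 1
  one-peak = trans (peaks-U⁺D p _) (cong suc (trans (peaks-Dⁿ++ q _) (peaks-Uⁿ (suc r))))
...     | followedBy r w₃ with leadingRun D w₃
...       | only s          = p , q , r , s , refl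
...       | followedBy s w₄ = contradiction peaks-U∷w₄≡0 (>⇒≢ (DyckSuffix-U∷⇒peak w₄ dyck-U∷w₄))
  where
  peaks-U∷w₄≡0 : peaks (U ∷ w₄) ≡ 0
  peaks-U∷w₄≡0 = suc-injective (suc-injective (begin
    2 + peaks (U ∷ w₄)                                                ≡⟨ cong (2 +_) (peaks-Dⁿ++ s _) ⟨
    2 + peaks (replicate s D ++ U ∷ w₄)                               ≡⟨ cong suc (peaks-U⁺D r _) ⟨
    1 + peaks (replicate (suc r) U ++ D ∷ replicate s D ++ U ∷ w₄)    ≡⟨ cong suc (peaks-Dⁿ++ q _) ⟨
    1 + peaks (replicate q D ++ U ∷ replicate r U ++ D ∷ replicate s D ++ U ∷ w₄) ≡⟨ peaks-U⁺D p _ ⟨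
    peaks w                                                           ≡⟨ two ⟩
    2 ∎))
    where open ≡-Reasoning
  dyck-U∷w₄ : DyckSuffix (U ∷ w₄)
  dyck-U∷w₄ = DyckSuffix-++⁻ (D ∷ replicate s D) (DyckSuffix-++⁻ (U ∷ replicate r U)
                (DyckSuffix-++⁻ (D ∷ replicate q D) (DyckSuffix-++⁻ (replicate (suc p) U) (0 , dyck))))

replicate⁺ : m ≤ n → replicate m x ⊆ replicate n x
replicate⁺ {n = n} z≤n = []⊆-universal (replicate n _)
replicate⁺ (s≤s m≤n)   = refl ∷ replicate⁺ m≤n

UDUD⁺ : p ≤ p′ → q ≤ q′ → r ≤ r′ → s ≤ s′ → UDUD p q r s ⊆ UDUD p′ q′ r′ s′
UDUD⁺ p≤p′ q≤q′ r≤r′ s≤s′ =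
  ++⁺ (replicate⁺ p≤p′) (++⁺ (replicate⁺ q≤q′) (++⁺ (replicate⁺ r≤r′) (replicate⁺ s≤s′)))

UD⊆UDUD : ∀ p q r s → UD ⊆ UDUD (suc p) (suc q) r s
UD⊆UDUD p q r s = refl ∷ ++⁺ˡ (replicate p U) (refl ∷ []⊆-universal _)

⊆-skip-replicate : x ≢ y → ∀ n → x ∷ xs ⊆ replicate n y ++ ys → x ∷ xs ⊆ ys
⊆-skip-replicate x≢y zero    sub          = sub
⊆-skip-replicate x≢y (suc n) (_ ∷ʳ sub)   = ⊆-skip-replicate x≢y n sub
⊆-skip-replicate x≢y (suc n) (x≡y ∷ _)    = contradiction x≡y x≢y

run-⊆ : x ≢ y → ∀ p n → replicate p x ++ y ∷ xs ⊆ replicate n x ++ y ∷ ys →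
        (p ≤ n × y ∷ xs ⊆ y ∷ ys) ⊎ (x ∷ y ∷ xs ⊆ ys)
run-⊆ x≢y zero    n       sub         = inj₁ (z≤n , ⊆-skip-replicate (x≢y ∘ sym) n sub)
run-⊆ x≢y (suc p) zero    (_ ∷ʳ sub)  = inj₂ (⊆-trans (refl ∷ ++⁺ˡ (replicate p _) ⊆-refl) sub)
run-⊆ x≢y (suc p) zero    (x≡y ∷ _)   = contradiction x≡y x≢y
run-⊆ x≢y (suc p) (suc n) (_ ∷ʳ sub)  with run-⊆ x≢y (suc p) n sub
... | inj₁ (p≤n , rest) = inj₁ (m≤n⇒m≤1+n p≤n , rest)
... | inj₂ overflow     = inj₂ overflow
run-⊆ x≢y (suc p) (suc n) (refl ∷ sub) with run-⊆ x≢y p n sub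
... | inj₁ (p≤n , rest) = inj₁ (s≤s p≤n , rest)
... | inj₂ overflow     = inj₂ overflow

U∷⊈Dⁿ : ∀ n → ¬ (U ∷ xs ⊆ replicate n D)
U∷⊈Dⁿ (suc n) (_ ∷ʳ sub) = U∷⊈Dⁿ n sub

DU⊈UᵐDⁿ : ∀ m n → ¬ (D ∷ U ∷ [] ⊆ replicate m U ++ replicate n D)
DU⊈UᵐDⁿ m n sub = U∷⊈Dⁿ n (∷ˡ⁻ (⊆-skip-replicate (U≢D ∘ sym) m sub))

UDU⊈DˡUᵐDⁿ : ∀ l m n → ¬ (U ∷ D ∷ U ∷ [] ⊆ replicate l D ++ replicate m U ++ replicate n D)
UDU⊈DˡUᵐDⁿ l m n sub = DU⊈UᵐDⁿ m n (∷ˡ⁻ (⊆-skip-replicate U≢D l sub))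

UDUD⁻ : UDUD (suc p) (suc q) (suc r) (suc s) ⊆ UDUD p′ (suc q′) (suc r′) (suc s′) →
        suc p ≤ p′ × suc q ≤ suc q′ × suc r ≤ suc r′ × suc s ≤ suc s′
UDUD⁻ {p} {q} {r} {s} {p′} {q′} {r′} {s′} sub with run-⊆ U≢D (suc p) p′ sub
... | inj₂ overflow = contradiction
                        (⊆-trans (refl ∷ refl ∷ ++⁺ˡ (replicate q D) (refl ∷ []⊆-universal _)) overflow)
                        (UDU⊈DˡUᵐDⁿ q′ (suc r′) (suc s′))
... | inj₁ (p≤p′ , sub₁) with run-⊆ (U≢D ∘ sym) (suc q) (suc q′) sub₁
...   | inj₂ overflow = contradiction (⊆-trans (refl ∷ refl ∷ []⊆-universal _) overflow)
                                      (DU⊈UᵐDⁿ r′ (suc s′))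
...   | inj₁ (q≤q′ , sub₂) with run-⊆ U≢D (suc r) (suc r′) sub₂
...     | inj₂ overflow      = contradiction overflow (U∷⊈Dⁿ s′)
...     | inj₁ (r≤r′ , sub₃) = p≤p′ , q≤q′ , r≤r′ ,
          subst₂ _≤_ (length-replicate (suc s)) (length-replicate (suc s′)) (length-mono-≤ sub₃)

UDUD-injective : UDUD (suc p) (suc q) (suc r) (suc s) ≡ UDUD (suc p′) (suc q′) (suc r′) (suc s′) →
                 p ≡ p′ × q ≡ q′ × r ≡ r′ × s ≡ s′
UDUD-injective eq
  with p≤ , q≤ , r≤ , s≤ ← UDUD⁻ (⊆-reflexive eq)
     | p≥ , q≥ , r≥ , s≥ ← UDUD⁻ (⊆-reflexive (sym eq))
  = antisym p≤ p≥ , antisym q≤ q≥ , antisym r≤ r≥ , antisym s≤ s≥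
  where
  antisym : suc m ≤ suc n → suc n ≤ suc m → m ≡ n
  antisym m≤n n≤m = suc-injective (≤-antisym m≤n n≤m)

Unique-wordsOfLength : ∀ n → Unique (wordsOfLength n)
Unique-wordsOfLength zero    = [] ∷ []
Unique-wordsOfLength (suc n) =
  Unique-concatMap⁺ (drop 1) tagged (λ _ → ((λ ()) ∷ []) ∷ [] ∷ []) (Unique-wordsOfLength n)
  where
  tagged : ∀ w {v} → v ∈ (U ∷ w) ∷ (D ∷ w) ∷ [] → drop 1 v ≡ w
  tagged w (here refl)         = refl
  tagged w (there (here refl)) = refl

∈-wordsOfLength⁻ : ∀ n {w} → w ∈ wordsOfLength n → length w ≡ n
∈-wordsOfLength⁻ zero    (here refl) = refl
∈-wordsOfLength⁻ (suc n) w∈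
  with v , v∈ , w∈v ← find (∈-concatMap⁻ _ {xs = wordsOfLength n} w∈) with w∈v
... | here refl         = cong suc (∈-wordsOfLength⁻ n v∈)
... | there (here refl) = cong suc (∈-wordsOfLength⁻ n v∈)

∈-wordsOfLength⁺ : ∀ w → w ∈ wordsOfLength (length w)
∈-wordsOfLength⁺ []      = here refl
∈-wordsOfLength⁺ (U ∷ w) = ∈-concatMap⁺ _ (lose (∈-wordsOfLength⁺ w) (here refl))
∈-wordsOfLength⁺ (D ∷ w) = ∈-concatMap⁺ _ (lose (∈-wordsOfLength⁺ w) (there (here refl)))

∈-wordsUpTo⁻ : ∀ n {w} → w ∈ wordsUpTo n → length w ≤ n
∈-wordsUpTo⁻ zero    (here refl) = z≤n
∈-wordsUpTo⁻ (suc n) w∈ with ∈-++⁻ (wordsOfLength (suc n)) w∈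
... | inj₁ w∈ = ≤-reflexive (∈-wordsOfLength⁻ (suc n) w∈)
... | inj₂ w∈ = m≤n⇒m≤1+n (∈-wordsUpTo⁻ n w∈)

∈-wordsUpTo⁺ : ∀ n w → length w ≤ n → w ∈ wordsUpTo n
∈-wordsUpTo⁺ zero    []  _    = here refl
∈-wordsUpTo⁺ (suc n) w   len≤ with m≤n⇒m<n∨m≡n len≤
... | inj₁ len< = ∈-++⁺ʳ (wordsOfLength (suc n)) (∈-wordsUpTo⁺ n w (≤-pred len<))
... | inj₂ len≡ = ∈-++⁺ˡ (subst (λ k → w ∈ wordsOfLength k) len≡ (∈-wordsOfLength⁺ w))

Unique-wordsUpTo : ∀ n → Unique (wordsUpTo n)
Unique-wordsUpTo zero    = [] ∷ []
Unique-wordsUpTo (suc n) = Unique.++⁺ (Unique-wordsOfLength (suc n)) (Unique-wordsUpTo n)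
  λ (w∈ , w∈′) → 1+n≰n (subst (_≤ n) (∈-wordsOfLength⁻ (suc n) w∈) (∈-wordsUpTo⁻ n w∈′))

≤+∸⇔+≤+ : ∀ {a c} h x → c ≤ a → (x ≤ h + (a ∸ c)) ⇔ (c + x ≤ a + h)
≤+∸⇔+≤+ {a} {c} h x c≤a = subst (λ k → (x ≤ k) ⇔ (c + x ≤ a + h)) a+h∸c≡h+[a∸c] (mk⇔ to from)
  where
  a+h∸c≡h+[a∸c] : a + h ∸ c ≡ h + (a ∸ c)
  a+h∸c≡h+[a∸c] = trans (cong (_∸ c) (+-comm a h)) (+-∸-assoc h c≤a)
  to : x ≤ a + h ∸ c → c + x ≤ a + h
  to x≤ = subst (_≤ a + h) (+-comm x c) (m≤o∸n⇒m+n≤o x (m≤n⇒m≤n+o h c≤a) x≤)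
  from : c + x ≤ a + h → x ≤ a + h ∸ c
  from c+x≤ = m+n≤o⇒m≤o∸n x (subst (_≤ a + h) (+-comm c x) c+x≤)

module Valleys (a b : ℕ) where

  Triple : Set
  Triple = ℕ × ℕ × ℕ

  valleyOf : Triple → Word
  valleyOf (q , x , r) = valley (suc q) x (suc r)

  Fits : ℕ → Triple → Set
  Fits h (q , x , r) = suc q + x ≤ a + h × suc q ≤ a × suc r ≤ b × suc r + x ≤ b + h

  slack : ℕ → ℕ → ℕ
  slack q r = (a ∸ suc q) ⊓ (b ∸ suc r)

  column : ℕ → ℕ × ℕ → List Triple
  column h (q , r) = map (λ x → q , x , r) (downFrom (suc (h + slack q r)))

  pairs : List (ℕ × ℕ)
  pairs = cartesianProduct (downFrom a) (downFrom b)

  solutions : ℕ → List Triple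
  solutions h = concatMap (column h) pairs

  ≤slack⇔Fits : ∀ h q x r → q < a → r < b → (x ≤ h + slack q r) ⇔ Fits h (q , x , r)
  ≤slack⇔Fits h q x r q<a r<b = mk⇔ to from
    where
    bound-a = ≤+∸⇔+≤+ h x q<a
    bound-b = ≤+∸⇔+≤+ h x r<b
    to : x ≤ h + slack q r → Fits h (q , x , r)
    to x≤ = let x≤′ = subst (x ≤_) (+-distribˡ-⊓ h _ _) x≤ in
      Equivalence.to bound-a (m≤n⊓o⇒m≤n _ _ x≤′) , q<a , r<b ,
      Equivalence.to bound-b (m≤n⊓o⇒m≤o _ _ x≤′)
    from : Fits h (q , x , r) → x ≤ h + slack q r
    from (fits-a , _ , _ , fits-b) = subst (x ≤_) (sym (+-distribˡ-⊓ h _ _))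
      (⊓-glb (Equivalence.from bound-a fits-a) (Equivalence.from bound-b fits-b))

  ∈-solutions⁻ : ∀ h {t} → t ∈ solutions h → Fits h t
  ∈-solutions⁻ h t∈ with (q , r) , qr∈ , t∈column ← find (∈-concatMap⁻ (column h) {xs = pairs} t∈)
                    with x , x∈ , refl ← ∈-map⁻ (λ x → q , x , r) t∈column
                    with q∈ , r∈ ← ∈-cartesianProduct⁻ (downFrom a) (downFrom b) qr∈
    = Equivalence.to (≤slack⇔Fits h q x r (∈-downFrom⁻ q∈) (∈-downFrom⁻ r∈)) (≤-pred (∈-downFrom⁻ x∈))

  ∈-solutions⁺ : ∀ h t → Fits h t → t ∈ solutions h
  ∈-solutions⁺ h (q , x , r) fits@(_ , q<a , r<b , _) =
    ∈-concatMap⁺ _ (lose (∈-cartesianProduct⁺ (∈-downFrom⁺ q<a) (∈-downFrom⁺ r<b))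
      (∈-map⁺ (λ x → q , x , r)
        (∈-downFrom⁺ (s≤s (Equivalence.from (≤slack⇔Fits h q x r q<a r<b) fits)))))

  Unique-solutions : ∀ h → Unique (solutions h)
  Unique-solutions h = Unique-concatMap⁺ (λ (q , _ , r) → q , r) tagged Unique-column
    (Unique.cartesianProduct⁺ (Unique.downFrom⁺ a) (Unique.downFrom⁺ b))
    where
    tagged : ∀ qr {t} → t ∈ column h qr → (proj₁ t , proj₂ (proj₂ t)) ≡ qr
    tagged (q , r) t∈ with _ , _ , refl ← ∈-map⁻ (λ x → q , x , r) t∈ = refl
    Unique-column : ∀ qr → Unique (column h qr)
    Unique-column (q , r) = Unique.map⁺ (λ { refl → refl }) (Unique.downFrom⁺ _)

  length-column : ∀ h qr → length (column h qr) ≡ suc (h + slack (proj₁ qr) (proj₂ qr))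
  length-column h (q , r) = trans (length-map (λ x → q , x , r) (downFrom (suc (h + slack q r))))
                                  (length-downFrom (suc (h + slack q r)))

  length-solutions : ∀ h → length (solutions h) ≡ h * (a * b) + length (solutions 0)
  length-solutions h = begin
    length (solutions h)
      ≡⟨ length-concatMap-shift (column h) (column 0) h column-shift pairs ⟩
    h * length pairs + length (solutions 0)
      ≡⟨ cong (λ n → h * n + length (solutions 0)) length-pairs ⟩
    h * (a * b) + length (solutions 0) ∎
    where
    open ≡-Reasoning
    column-shift : ∀ qr → length (column h qr) ≡ h + length (column 0 qr)
    column-shift qr =
      trans (length-column h qr) (trans (sym (+-suc h _)) (cong (h +_) (sym (length-column 0 qr))))
    length-pairs : length pairs ≡ a * b
    length-pairs = trans (length-cartesianProduct (downFrom a) (downFrom b))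
                         (cong₂ _*_ (length-downFrom a) (length-downFrom b))

module Interval (a b : ℕ) where

  open Valleys (suc a) (suc b) public

  inInterval⇒valley : ∀ h w → InIntervalTwoPeaks (Q h (suc a) (suc b)) w →
                      ∃[ t ] Fits h t × w ≡ valleyOf t
  inInterval⇒valley h w (dyck , _ , w⊆Q , two)
    with p , q , r , s , refl ← twoPeakDyck⇒UDUD w dyck two
    with x , refl , refl ← dyck-UDUD⁻ (suc p) (suc q) (suc r) (suc s) dyck
    = (q , x , r) , UDUD⁻ w⊆Q , refl

  valley⇒inInterval : ∀ h t → Fits h t → InIntervalTwoPeaks (Q h (suc a) (suc b)) (valleyOf t)
  valley⇒inInterval h (q , x , r) (p≤ , q≤ , r≤ , s≤) =
    dyck-valley (suc q) x (suc r) ,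
    UD⊆UDUD (q + x) q (suc r) (suc (r + x)) ,
    UDUD⁺ p≤ q≤ r≤ s≤ ,
    peaks-UDUD (q + x) q r (r + x)

  valleyOf-injective : ∀ {t t′} → valleyOf t ≡ valleyOf t′ → t ≡ t′
  valleyOf-injective {q , x , r} {_ , x′ , _} eq with q+x≡q+x′ , refl , refl , _ ← UDUD-injective eq
    = cong (λ x → q , x , r) (+-cancelˡ-≡ q x x′ q+x≡q+x′)

  φ≡length-solutions : ∀ h → φ h (suc a) (suc b) ≡ length (solutions h)
  φ≡length-solutions h = begin
    φ h (suc a) (suc b)
      ≡⟨ unique∧set⇒length≡ (Unique.filter⁺ P? (Unique-wordsUpTo (length R)))
                            (Unique.map⁺ valleyOf-injective (Unique-solutions h)) (mk⇔ to from) ⟩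
    length (map valleyOf (solutions h))
      ≡⟨ length-map valleyOf (solutions h) ⟩
    length (solutions h) ∎
    where
    open ≡-Reasoning
    R = Q h (suc a) (suc b)
    P? = inIntervalTwoPeaks? R
    to : ∀ {w} → w ∈ filter P? (wordsUpTo (length R)) → w ∈ map valleyOf (solutions h)
    to w∈ with _ , inInterval ← ∈-filter⁻ P? {xs = wordsUpTo (length R)} w∈
          with t , fits , refl ← inInterval⇒valley h _ inInterval
      = ∈-map⁺ valleyOf (∈-solutions⁺ h t fits)
    from : ∀ {w} → w ∈ map valleyOf (solutions h) → w ∈ filter P? (wordsUpTo (length R))
    from w∈ with t , t∈ , refl ← ∈-map⁻ valleyOf w∈
      = let inInterval@(_ , _ , t⊆R , _) = valley⇒inInterval h t (∈-solutions⁻ h t∈) in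
        ∈-filter⁺ P? (∈-wordsUpTo⁺ (length R) (valleyOf t) (length-mono-≤ t⊆R)) inInterval

mainTheorem6 : (a b h : ℕ) → 1 ≤ a → a ≤ b →
               φ h a b ≡ φ 0 a b + h * a * b
mainTheorem6 (suc a) (suc b) h _ (s≤s _) = begin
  φ h (suc a) (suc b)                                    ≡⟨ φ≡length-solutions h ⟩
  length (solutions h)                                   ≡⟨ length-solutions h ⟩
  h * (suc a * suc b) + length (solutions 0)             ≡⟨ +-comm _ (length (solutions 0)) ⟩
  length (solutions 0) + h * (suc a * suc b)             ≡⟨ cong₂ _+_ (φ≡length-solutions 0) (*-assoc h _ _) ⟨
  φ 0 (suc a) (suc b) + h * suc a * suc b                ∎
  where
  open ≡-Reasoning
  open Interval a b
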